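{- Let $q=q_1\cdots q_k$ be a pattern of length $k$ with $q_1=1$, and let $q'=1\,(q_1+1)(q_2+1)\cdots(q_k+1)$ be the pattern of length $k+1$ obtained by adding 1 to each entry of $q$ and prepending the entry 1. Let $c$ be a constant such that $S_n(q)<c^n$ for all $n$. Then for all $n$, $S_n(q')<(1+\sqrt{c})^{2n}=(1+c+2\sqrt{c})^n$.
   Context: A permutation $p=p_1\cdots p_n$ of $[n]$ contains a pattern $q$ (a permutation of $[k]$) if there are indices $i_1<\dots<i_k$ with $p_{i_a}<p_{i_b}$ iff $q_a<q_b$; otherwise $p$ avoids $q$. $S_n(q)$ is the number of permutations of length $n$ avoiding $q$. -}

module Defs where

open import Data.Nat using (ℕ; zero; suc)
open import Data.Fin using (Fin) renaming (_<_ to _<ᶠ_)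
open import Data.Vec using (Vec; lookup; _∷_; map)
open import Data.Integer using (+_)
open import Data.Rational using (ℚ; _/_; _*_; _+_; _<_; _≤_; 0ℚ; 1ℚ)
open import Data.Product using (Σ; ∃; _×_)
open import Data.Refinement using (Refinement-syntax)
open import Relation.Binary.PropositionalEquality using (_≡_)
open import Relation.Nullary using (¬_)
open import Function.Bundles using (_↔_)
open import Level using (0ℓ) renaming (suc to lsuc)

-- Permutations (one-line notation, values 0-based: entry j stands for j+1)

-- a word of length n over Fin n is a permutation of [n] iff it is injective
IsPerm : ∀ {n} → Vec (Fin n) n → Set
IsPerm {n} p = ∀ (i j : Fin n) → lookup p i ≡ lookup p j → i ≡ j

Contains : ∀ {n k} → Vec (Fin n) n → Vec (Fin k) k → Set
Contains {n} {k} p q =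
  Σ (Fin k → Fin n) λ e →
    (∀ (a b : Fin k) → a <ᶠ b → e a <ᶠ e b) ×
    (∀ (a b : Fin k) →
       (lookup p (e a) <ᶠ lookup p (e b) → lookup q a <ᶠ lookup q b) ×
       (lookup q a <ᶠ lookup q b → lookup p (e a) <ᶠ lookup p (e b)))

Avoids : ∀ {n k} → Vec (Fin n) n → Vec (Fin k) k → Set
Avoids p q = ¬ Contains p q

-- The set of permutations of length n avoiding q (proof part irrelevant, so
-- elements are determined by their one-line notation).
Avoiders : ∀ {k} → ℕ → Vec (Fin k) k → Set
Avoiders n q = [ p ∈ Vec (Fin n) n ∣ IsPerm p × Avoids p q ]

-- "S_n(q) = m": the avoiders of length n are in bijection with Fin m.
-- (Avoiders n q is finite with decidable equality, so exactly one such m.)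
HasCount : ∀ {k} → ℕ → Vec (Fin k) k → ℕ → Set
HasCount n q m = Avoiders n q ↔ Fin m

extend : ∀ {k} → Vec (Fin k) k → Vec (Fin (suc k)) (suc k)
extend q = Fin.zero ∷ map Fin.suc q
  where import Data.Fin as Fin

-- Positive real numbers, as open lower Dedekind cuts of ℚ
-- (Lower r  means  r < c).

record PosReal : Set₁ where
  field
    Lower    : ℚ → Set
    pos      : Lower 0ℚ
    bounded  : ∃ λ r → ¬ Lower r
    downward : ∀ {r s} → s ≤ r → Lower r → Lower s
    rounded  : ∀ {r} → Lower r → ∃ λ s → r < s × Lower s
open PosReal public

ℕ→ℚ : ℕ → ℚ
ℕ→ℚ m = + m / 1

_^ℚ_ : ℚ → ℕ → ℚ
x ^ℚ zero  = 1ℚ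
x ^ℚ suc n = x * (x ^ℚ n)

-- (m : ℕ) < c^n   for a positive real c  (c^n is increasing in c > 0)
_<pow_^_ : ℕ → PosReal → ℕ → Set
m <pow c ^ n = ∃ λ r → Lower c r × 0ℚ ≤ r × ℕ→ℚ m < r ^ℚ n

-- (m : ℕ) < (1 + √c)^(2n)   for a positive real c:
-- √c is the supremum of the s ≥ 0 with s² < c.
_<onePlusSqrt_^2*_ : ℕ → PosReal → ℕ → Set
m <onePlusSqrt c ^2* n =
  ∃ λ s → 0ℚ ≤ s × Lower c (s * s) × ℕ→ℚ m < (1ℚ + s) ^ℚ (n Data.Nat.+ n)
  where import Data.Nat

-- A permutation p avoiding extend q is determined by three pieces of data: the
-- positions of its left-to-right minima, the values of those minima, and the
-- pattern σ of the remaining entries. As q starts with its minimum, an occurrence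
-- of q in σ would extend, by an earlier and smaller left-to-right minimum, to an
-- occurrence of extend q in p; so σ avoids q. If t entries are not minima there
-- are at most C(n,t)² S_t(q) such triples, and a single rational R < c gives
-- S_t(q) ≤ R^t for all t ≤ n. For rationals s₀ < s with R ≤ s₀² and s² < c,
-- Σ_t C(n,t)² s₀^(2t) ≤ (Σ_t C(n,t) s₀^t)² = (1 + s₀)^(2n) < (1 + s)^(2n).

module Submission where

open import Defs
open import Data.Nat using (ℕ; suc)
open import Data.Fin using (Fin; zero)
open import Data.Vec using (Vec; head)
open import Relation.Binary.PropositionalEquality using (_≡_)

module BitVector where

  open import Data.Bool using (Bool; true; false; if_then_else_)
  open import Data.Nat using (ℕ; zero; suc; _+_; _≤_; _<_; z≤n; s≤s)
  import Data.Nat.Properties as ℕ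
  open import Data.Fin using (Fin; zero; suc; toℕ; fromℕ<) renaming (_<_ to _<ᶠ_)
  import Data.Fin.Properties as Fin
  open import Data.Vec using (Vec; []; _∷_; lookup; tabulate)
  open import Data.Empty using (⊥-elim)
  open import Data.Vec.Properties using (lookup∘tabulate)
  open import Relation.Binary.Definitions using (tri<; tri≈; tri>)
  open import Relation.Binary.PropositionalEquality
  open import Relation.Nullary using (¬_; does; proof)
  open import Relation.Nullary.Decidable using (dec-true)
  open import Relation.Nullary.Reflects using (Reflects; invert)
  open import Relation.Unary using (Pred; Decidable)
  open import Level using (0ℓ)

  private
    variable
      n : ℕ

  sucIfEq : Bool → Bool → ℕ → ℕ
  sucIfEq true  true  m = suc m
  sucIfEq false false m = suc m
  sucIfEq true  false m = m
  sucIfEq false true  m = m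

  sucIfEq-mono-< : ∀ b x {l m} → l < m → sucIfEq b x l < sucIfEq b x m
  sucIfEq-mono-< true  true  l<m = s≤s l<m
  sucIfEq-mono-< false false l<m = s≤s l<m
  sucIfEq-mono-< true  false l<m = l<m
  sucIfEq-mono-< false true  l<m = l<m

  sucIfEq-refl : ∀ b m → sucIfEq b b m ≡ suc m
  sucIfEq-refl true  m = refl
  sucIfEq-refl false m = refl

  count : Bool → Vec Bool n → ℕ
  count b []      = 0
  count b (x ∷ A) = sucIfEq b x (count b A)

  rank : Bool → Vec Bool n → Fin n → ℕ
  rank b (x ∷ A) zero    = 0
  rank b (x ∷ A) (suc v) = sucIfEq b x (rank b A v)

  select : ∀ b (A : Vec Bool n) → Fin (count b A) → Fin n
  select true  (true  ∷ A) zero    = zero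
  select true  (true  ∷ A) (suc i) = suc (select true A i)
  select false (false ∷ A) zero    = zero
  select false (false ∷ A) (suc i) = suc (select false A i)
  select true  (false ∷ A) i       = suc (select true A i)
  select false (true  ∷ A) i       = suc (select false A i)

  count-true+count-false : (A : Vec Bool n) → count true A + count false A ≡ n
  count-true+count-false []          = refl
  count-true+count-false (true  ∷ A) = cong suc (count-true+count-false A)
  count-true+count-false (false ∷ A) =
    trans (ℕ.+-suc (count true A) (count false A)) (cong suc (count-true+count-false A))

  rank<count : ∀ b (A : Vec Bool n) v → lookup A v ≡ b → rank b A v < count b A
  rank<count b (x ∷ A) zero    refl rewrite sucIfEq-refl x (count x A) = s≤s z≤n
  rank<count b (x ∷ A) (suc v) Av≡b = sucIfEq-mono-< b x (rank<count b A v Av≡b)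

  rank-mono-< : ∀ b (A : Vec Bool n) {v w} → v <ᶠ w → lookup A v ≡ b → rank b A v < rank b A w
  rank-mono-< b (x ∷ A) {zero}  {suc w} _         refl rewrite sucIfEq-refl x (rank x A w) = s≤s z≤n
  rank-mono-< b (x ∷ A) {suc v} {suc w} (s≤s v<w) Av≡b = sucIfEq-mono-< b x (rank-mono-< b A v<w Av≡b)

  module _ (b : Bool) (A : Vec Bool n) {v w : Fin n} (Av≡b : lookup A v ≡ b) (Aw≡b : lookup A w ≡ b) where

    rank-injective : rank b A v ≡ rank b A w → v ≡ w
    rank-injective eq with Fin.<-cmp v w
    ... | tri< v<w _ _ = ⊥-elim (ℕ.<-irrefl eq (rank-mono-< b A v<w Av≡b))
    ... | tri≈ _ v≡w _ = v≡w
    ... | tri> _ _ w<v = ⊥-elim (ℕ.<-irrefl (sym eq) (rank-mono-< b A w<v Aw≡b))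

    rank-cancel-< : rank b A v < rank b A w → v <ᶠ w
    rank-cancel-< lt with Fin.<-cmp v w
    ... | tri< v<w _ _ = v<w
    ... | tri≈ _ refl _ = ⊥-elim (ℕ.<-irrefl refl lt)
    ... | tri> _ _ w<v = ⊥-elim (ℕ.<-asym lt (rank-mono-< b A w<v Aw≡b))

  lookup-select : ∀ b (A : Vec Bool n) i → lookup A (select b A i) ≡ b
  lookup-select true  (true  ∷ A) zero    = refl
  lookup-select true  (true  ∷ A) (suc i) = lookup-select true A i
  lookup-select false (false ∷ A) zero    = refl
  lookup-select false (false ∷ A) (suc i) = lookup-select false A i
  lookup-select true  (false ∷ A) i       = lookup-select true A i
  lookup-select false (true  ∷ A) i       = lookup-select false A i

  rank-select : ∀ b (A : Vec Bool n) i → rank b A (select b A i) ≡ toℕ i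
  rank-select true  (true  ∷ A) zero    = refl
  rank-select true  (true  ∷ A) (suc i) = cong suc (rank-select true A i)
  rank-select false (false ∷ A) zero    = refl
  rank-select false (false ∷ A) (suc i) = cong suc (rank-select false A i)
  rank-select true  (false ∷ A) i       = rank-select true A i
  rank-select false (true  ∷ A) i       = rank-select false A i

  select-rank : ∀ b (A : Vec Bool n) v (Av≡b : lookup A v ≡ b) →
                select b A (fromℕ< (rank<count b A v Av≡b)) ≡ v
  select-rank b A v Av≡b = rank-injective b A (lookup-select b A _) Av≡b
    (trans (rank-select b A _) (Fin.toℕ-fromℕ< (rank<count b A v Av≡b)))

  select-injective : ∀ b (A : Vec Bool n) {i j} → select b A i ≡ select b A j → i ≡ j
  select-injective b A {i} {j} eq = Fin.toℕ-injective (begin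
    toℕ i                    ≡⟨ sym (rank-select b A i) ⟩
    rank b A (select b A i)  ≡⟨ cong (rank b A) eq ⟩
    rank b A (select b A j)  ≡⟨ rank-select b A j ⟩
    toℕ j                    ∎)
    where open ≡-Reasoning

  select-mono-< : ∀ b (A : Vec Bool n) {i j} → i <ᶠ j → select b A i <ᶠ select b A j
  select-mono-< b A {i} {j} i<j = rank-cancel-< b A (lookup-select b A i) (lookup-select b A j)
    (subst₂ _<_ (sym (rank-select b A i)) (sym (rank-select b A j)) i<j)

  count-mono : ∀ b (A B : Vec Bool n) (f : Fin n → Fin n) → (∀ {i j} → f i ≡ f j → i ≡ j) →
               (∀ v → lookup A v ≡ b → lookup B (f v) ≡ b) → count b A ≤ count b B
  count-mono b A B f f-injective f-resp = Fin.injective⇒≤ {f = g} g-injective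
    where
    Bf≡b : ∀ i → lookup B (f (select b A i)) ≡ b
    Bf≡b i = f-resp _ (lookup-select b A i)
    g : Fin (count b A) → Fin (count b B)
    g i = fromℕ< (rank<count b B _ (Bf≡b i))
    g-injective : ∀ {i j} → g i ≡ g j → i ≡ j
    g-injective {i} {j} eq = select-injective b A (f-injective (rank-injective b B (Bf≡b i) (Bf≡b j)
      (trans (sym (Fin.toℕ-fromℕ< _)) (trans (cong toℕ eq) (Fin.toℕ-fromℕ< _)))))

  count-false-reindex : ∀ {n} (A B : Vec Bool n) (f : Fin n → Fin n) → (∀ {i j} → f i ≡ f j → i ≡ j) →
                        (∀ v → lookup B (f v) ≡ lookup A v) → count false A ≡ count false B
  count-false-reindex {n} A B f f-injective B∘f≗A = ℕ.≤-antisym false≤ (ℕ.+-cancelˡ-≤ (count true B) _ _ (begin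
    count true B + count false B  ≡⟨ count-true+count-false B ⟩
    n                             ≡⟨ sym (count-true+count-false A) ⟩
    count true A + count false A  ≤⟨ ℕ.+-monoˡ-≤ (count false A) true≤ ⟩
    count true B + count false A  ∎))
    where
    open ℕ.≤-Reasoning
    respects : ∀ b v → lookup A v ≡ b → lookup B (f v) ≡ b
    respects b v Av≡b = trans (B∘f≗A v) Av≡b
    true≤  = count-mono true  A B f f-injective (respects true)
    false≤ = count-mono false A B f f-injective (respects false)

  indicator : {P : Pred (Fin n) 0ℓ} → Decidable P → Vec Bool n
  indicator P? = tabulate (λ x → does (P? x))

  lookup-indicator : {P : Pred (Fin n) 0ℓ} (P? : Decidable P) (x : Fin n) →
                     lookup (indicator P?) x ≡ does (P? x)
  lookup-indicator P? = lookup∘tabulate (λ x → does (P? x))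

  lookup-indicator⁺ : {P : Pred (Fin n) 0ℓ} (P? : Decidable P) {x : Fin n} →
                      P x → lookup (indicator P?) x ≡ true
  lookup-indicator⁺ P? {x} px = trans (lookup-indicator P? x) (dec-true (P? x) px)

  lookup-indicator⁻ : {P : Pred (Fin n) 0ℓ} (P? : Decidable P) {b : Bool} (x : Fin n) →
                      lookup (indicator P?) x ≡ b → if b then P x else ¬ P x
  lookup-indicator⁻ {P = P} P? x eq =
    invert (subst (Reflects (P x)) (trans (sym (lookup-indicator P? x)) eq) (proof (P? x)))

module Occurrence where

  open import Data.Nat using (ℕ; suc; z≤n; s≤s)
  import Data.Nat.Properties as ℕ
  open import Data.Fin using (Fin; zero; suc) renaming (_<_ to _<ᶠ_)
  import Data.Fin.Properties as Fin
  open import Data.Vec using (Vec; _∷_; lookup; head)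
  open import Data.Vec.Properties using (lookup-map)
  open import Data.Vec.Functional using () renaming (_∷_ to _◂_)
  open import Data.Product using (_×_; _,_; proj₁; proj₂)
  open import Data.Empty using (⊥-elim)
  open import Function.Bundles using (_⇔_; Equivalence)
  open import Relation.Nullary using (Dec)
  open import Relation.Nullary.Decidable using (_×-dec_; _→-dec_)
  open import Relation.Binary.PropositionalEquality
  open Equivalence using (to; from)

  private
    variable
      k n m : ℕ

  StrictlyIncreasing : (Fin k → Fin n) → Set
  StrictlyIncreasing e = ∀ a b → a <ᶠ b → e a <ᶠ e b

  -- Contains p q is Σ e (IsOccurrence (lookup p) q e) by definition.
  IsOccurrence : (Fin n → Fin m) → Vec (Fin k) k → (Fin k → Fin n) → Set
  IsOccurrence w q e = StrictlyIncreasing e ×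
    (∀ a b → (w (e a) <ᶠ w (e b) → lookup q a <ᶠ lookup q b) ×
             (lookup q a <ᶠ lookup q b → w (e a) <ᶠ w (e b)))

  isOccurrence? : (w : Fin n → Fin m) (q : Vec (Fin k) k) (e : Fin k → Fin n) →
                  Dec (IsOccurrence w q e)
  isOccurrence? w q e =
    Fin.all? (λ a → Fin.all? λ b → (a Fin.<? b) →-dec (e a Fin.<? e b)) ×-dec
    Fin.all? (λ a → Fin.all? λ b →
      ((w (e a) Fin.<? w (e b)) →-dec (lookup q a Fin.<? lookup q b)) ×-dec
      ((lookup q a Fin.<? lookup q b) →-dec (w (e a) Fin.<? w (e b))))

  IsOccurrence-resp-≗ : ∀ {w : Fin n → Fin m} {q : Vec (Fin k) k} {e e'} →
                        (∀ a → e a ≡ e' a) → IsOccurrence w q e → IsOccurrence w q e'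
  IsOccurrence-resp-≗ {w = w} e≗e' (increasing , iff) =
    (λ a b a<b → subst₂ _<ᶠ_ (e≗e' a) (e≗e' b) (increasing a b a<b)) ,
    (λ a b → (λ lt → proj₁ (iff a b) (subst₂ (λ x y → w x <ᶠ w y) (sym (e≗e' a)) (sym (e≗e' b)) lt)) ,
             (λ lt → subst₂ (λ x y → w x <ᶠ w y) (e≗e' a) (e≗e' b) (proj₂ (iff a b) lt)))

  IsOccurrence-∘ : ∀ {t} {w : Fin n → Fin m} {σ : Fin t → Fin t} {f : Fin t → Fin n}
                   {q : Vec (Fin k) k} {e : Fin k → Fin t} →
                   StrictlyIncreasing f → (∀ i j → σ i <ᶠ σ j ⇔ w (f i) <ᶠ w (f j)) →
                   IsOccurrence σ q e → IsOccurrence w q (λ a → f (e a))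
  IsOccurrence-∘ {e = e} f-increasing σ≅wf (e-increasing , iff) =
    (λ a b a<b → f-increasing (e a) (e b) (e-increasing a b a<b)) ,
    (λ a b → (λ lt → proj₁ (iff a b) (from (σ≅wf (e a) (e b)) lt)) ,
             (λ lt → to (σ≅wf (e a) (e b)) (proj₂ (iff a b) lt)))

  -- As q starts with its minimum, the first entry of an occurrence of q is its
  -- smallest; an earlier, smaller entry y then plays the role of the new first
  -- entry of extend q.
  prepend-occurrence : {w : Fin n → Fin m} (q : Vec (Fin (suc k)) (suc k)) →
                       IsPerm q → head q ≡ zero → ∀ {e} → IsOccurrence w q e →
                       ∀ y → y <ᶠ e zero → w y <ᶠ w (e zero) →
                       IsOccurrence w (extend q) (y ◂ e)
  prepend-occurrence {w = w} q@(_ ∷ _) q-perm refl {e} (e-increasing , iff) y y<e₀ wy<we₀ =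
    increasing , iff'
    where
    we₀<we : ∀ b → w (e zero) <ᶠ w (e (suc b))
    we₀<we b = proj₂ (iff zero (suc b))
      (Fin.≤∧≢⇒< z≤n (λ 0≡qb → Fin.0≢1+n (q-perm zero (suc b) 0≡qb)))
    wy<we : ∀ b → w y <ᶠ w (e b)
    wy<we zero    = wy<we₀
    wy<we (suc b) = Fin.<-trans wy<we₀ (we₀<we b)
    increasing : StrictlyIncreasing (y ◂ e)
    increasing zero    (suc zero)    _         = y<e₀
    increasing zero    (suc (suc b)) _         = Fin.<-trans y<e₀ (e-increasing zero (suc b) (s≤s z≤n))
    increasing (suc a) (suc b)       (s≤s a<b) = e-increasing a b a<b
    lookup-extend : ∀ a → lookup (extend q) (suc a) ≡ suc (lookup q a)
    lookup-extend a = lookup-map a suc q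
    iff' : ∀ a b → ((w ((y ◂ e) a) <ᶠ w ((y ◂ e) b) → lookup (extend q) a <ᶠ lookup (extend q) b) ×
                    (lookup (extend q) a <ᶠ lookup (extend q) b → w ((y ◂ e) a) <ᶠ w ((y ◂ e) b)))
    iff' zero    zero    = (λ lt → ⊥-elim (ℕ.<-irrefl refl lt)) , (λ lt → ⊥-elim (ℕ.<-irrefl refl lt))
    iff' zero    (suc b) = (λ _ → subst (lookup (extend q) zero <ᶠ_) (sym (lookup-extend b)) (s≤s z≤n)) , (λ _ → wy<we b)
    iff' (suc a) zero    = (λ lt → ⊥-elim (Fin.<-asym lt (wy<we a)))
                         , (λ lt → ⊥-elim (ℕ.n≮0 (subst (_<ᶠ lookup (extend q) zero) (lookup-extend a) lt)))
    iff' (suc a) (suc b) =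
      (λ lt → subst₂ _<ᶠ_ (sym (lookup-extend a)) (sym (lookup-extend b)) (s≤s (proj₁ (iff a b) lt))) ,
      (λ lt → proj₂ (iff a b) (ℕ.≤-pred (subst₂ _<ᶠ_ (lookup-extend a) (lookup-extend b) lt)))

module LeftToRightMinima {N : ℕ} (p : Vec (Fin N) N) (p-perm : IsPerm p) where

  open import Data.Bool using (Bool; false)
  open import Data.Nat using (_<_)
  import Data.Nat.Properties as ℕ
  open import Data.Fin using (zero; toℕ; fromℕ<) renaming (_<_ to _<ᶠ_)
  import Data.Fin.Properties as Fin
  open import Data.Vec using (lookup; tabulate; head)
  open import Data.Vec.Properties using (lookup∘tabulate)
  open import Data.Product using (∃; _×_; _,_)
  open import Data.Empty using (⊥-elim)
  open import Function.Bundles using (_⇔_; mk⇔)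
  open import Relation.Nullary using (¬_; Dec; yes; no; does)
  open import Relation.Nullary.Decidable using (_×-dec_; _→-dec_; dec-true; dec-false)
  open import Relation.Binary.PropositionalEquality
  open BitVector
  open Occurrence

  π : Fin N → Fin N
  π = lookup p

  IsMinimum : Fin N → Set
  IsMinimum x = ∀ y → y <ᶠ x → π x <ᶠ π y

  IsMinimumValue : Fin N → Set
  IsMinimumValue v = ∃ λ x → π x ≡ v × IsMinimum x

  -- Opaque, so that `with isMinimum? x` abstracts the decision instead of unfolding it.
  opaque
    isMinimum? : ∀ x → Dec (IsMinimum x)
    isMinimum? x = Fin.all? λ y → (y Fin.<? x) →-dec (π x Fin.<? π y)

    isMinimumValue? : ∀ v → Dec (IsMinimumValue v)
    isMinimumValue? v = Fin.any? λ x → (π x Fin.≟ v) ×-dec isMinimum? x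

  minPositions : Vec Bool N
  minPositions = indicator isMinimum?

  minValues : Vec Bool N
  minValues = indicator isMinimumValue?

  smaller-before-nonMinimum : ∀ x → ¬ IsMinimum x → ∃ λ y → y <ᶠ x × π y <ᶠ π x
  smaller-before-nonMinimum x ¬min with Fin.¬∀⟶∃¬ N _ (λ y → (y Fin.<? x) →-dec (π x Fin.<? π y)) ¬min
  ... | y , ¬[y<x⇒πx<πy] with y Fin.<? x
  ...   | no  y≮x = ⊥-elim (¬[y<x⇒πx<πy] (λ y<x → ⊥-elim (y≮x y<x)))
  ...   | yes y<x = y , y<x , Fin.≤∧≢⇒< (ℕ.≮⇒≥ λ πx<πy → ¬[y<x⇒πx<πy] λ _ → πx<πy)
                                         (λ πy≡πx → Fin.<⇒≢ y<x (p-perm y x πy≡πx))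

  minValues-π : ∀ x → lookup minValues (π x) ≡ lookup minPositions x
  minValues-π x = begin
    lookup minValues (π x)            ≡⟨ lookup-indicator isMinimumValue? (π x) ⟩
    does (isMinimumValue? (π x))      ≡⟨ agree ⟩
    does (isMinimum? x)               ≡⟨ sym (lookup-indicator isMinimum? x) ⟩
    lookup minPositions x             ∎
    where
    open ≡-Reasoning
    agree : does (isMinimumValue? (π x)) ≡ does (isMinimum? x)
    agree with isMinimum? x
    ... | yes min = dec-true (isMinimumValue? (π x)) (x , refl , min)
    ... | no ¬min = dec-false (isMinimumValue? (π x))
                      λ (x' , πx'≡πx , min') → ¬min (subst IsMinimum (p-perm x' x πx'≡πx) min')

  nonMinimumCount : ℕ
  nonMinimumCount = count false minPositions

  nonMinimumPosition : Fin nonMinimumCount → Fin N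
  nonMinimumPosition = select false minPositions

  count-nonMinimumValues : count false minPositions ≡ count false minValues
  count-nonMinimumValues = count-false-reindex minPositions minValues π (p-perm _ _) minValues-π

  nonMinimumValue-false : ∀ i → lookup minValues (π (nonMinimumPosition i)) ≡ false
  nonMinimumValue-false i = trans (minValues-π _) (lookup-select false minPositions i)

  -- The pattern of the entries of p that are not left-to-right minima.
  σ : Fin nonMinimumCount → Fin nonMinimumCount
  σ i = fromℕ< (subst (rank false minValues (π (nonMinimumPosition i)) <_)
                      (sym count-nonMinimumValues)
                      (rank<count false minValues _ (nonMinimumValue-false i)))

  toℕ-σ : ∀ i → toℕ (σ i) ≡ rank false minValues (π (nonMinimumPosition i))
  toℕ-σ i = Fin.toℕ-fromℕ< _

  σ-injective : ∀ {i j} → σ i ≡ σ j → i ≡ j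
  σ-injective {i} {j} eq = select-injective false minPositions (p-perm _ _
    (rank-injective false minValues (nonMinimumValue-false i) (nonMinimumValue-false j)
      (trans (sym (toℕ-σ i)) (trans (cong toℕ eq) (toℕ-σ j)))))

  σ-perm : IsPerm (tabulate σ)
  σ-perm i j eq = σ-injective (trans (sym (lookup∘tabulate σ i)) (trans eq (lookup∘tabulate σ j)))

  σ-<⇔ : ∀ i j → σ i <ᶠ σ j ⇔ π (nonMinimumPosition i) <ᶠ π (nonMinimumPosition j)
  σ-<⇔ i j = mk⇔
    (λ σi<σj → rank-cancel-< false minValues (nonMinimumValue-false i) (nonMinimumValue-false j)
                 (subst₂ _<_ (toℕ-σ i) (toℕ-σ j) σi<σj))
    (λ lt → subst₂ _<_ (sym (toℕ-σ i)) (sym (toℕ-σ j))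
                 (rank-mono-< false minValues lt (nonMinimumValue-false i)))

  σ-avoids : ∀ {k} (q : Vec (Fin (suc k)) (suc k)) → IsPerm q → head q ≡ zero →
             Avoids p (extend q) → Avoids (tabulate σ) q
  σ-avoids q q-perm q-head p-avoids (e , occurrence) with
    smaller-before-nonMinimum (nonMinimumPosition (e zero))
      (lookup-indicator⁻ isMinimum? _ (lookup-select false minPositions (e zero)))
  ... | y , y<x₀ , πy<πx₀ = p-avoids (_ , prepend-occurrence q q-perm q-head
          (IsOccurrence-∘ {w = π} {q = q} (λ _ _ → select-mono-< false minPositions) tabulate-σ-<⇔ occurrence)
          y y<x₀ πy<πx₀)
    where
    tabulate-σ-<⇔ : ∀ i j → lookup (tabulate σ) i <ᶠ lookup (tabulate σ) j ⇔
                            π (nonMinimumPosition i) <ᶠ π (nonMinimumPosition j)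
    tabulate-σ-<⇔ i j rewrite lookup∘tabulate σ i | lookup∘tabulate σ j = σ-<⇔ i j

module Reconstruction where

  open import Data.Bool using (Bool; true; false)
  open import Data.Nat using (zero; suc)
  import Data.Nat.Properties as ℕ
  open import Data.Fin using (zero; suc; toℕ; fromℕ<) renaming (_<_ to _<ᶠ_; _≤_ to _≤ᶠ_)
  import Data.Fin.Properties as Fin
  open import Data.Fin.Induction using (<-wellFounded)
  open import Data.Vec using (_∷_; lookup; tabulate)
  open import Data.Vec.Properties using (lookup∘tabulate; tabulate∘lookup; tabulate-cong)
  open import Data.List as List using (List; []; _∷_)
  open import Data.Product using (_×_; _,_; proj₁; proj₂)
  open import Data.Empty using (⊥-elim)
  open import Induction.WellFounded using (module All)
  open import Relation.Binary.Definitions using (tri<; tri≈; tri>)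
  open import Relation.Binary.PropositionalEquality
  open import Level using (0ℓ)
  open BitVector

  nth : List ℕ → ℕ → ℕ
  nth []       _       = 0
  nth (x ∷ xs) zero    = x
  nth (x ∷ xs) (suc i) = nth xs i

  entries : ∀ {m n} → Vec (Fin m) n → List ℕ
  entries v = List.tabulate (λ i → toℕ (lookup v i))

  nth-entries : ∀ {m n} (v : Vec (Fin m) n) i → nth (entries v) (toℕ i) ≡ toℕ (lookup v i)
  nth-entries (x ∷ v) zero    = refl
  nth-entries (x ∷ v) (suc i) = nth-entries v i

  Code : ℕ → Set
  Code N = Vec Bool N × Vec Bool N × List ℕ

  module _ {N : ℕ} (p : Vec (Fin N) N) (p-perm : IsPerm p) where
    open LeftToRightMinima p p-perm

    σ-list : List ℕ
    σ-list = entries (tabulate σ)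

    code : Code N
    code = minPositions , minValues , σ-list

    rank-nonMinimum : ∀ x → lookup minPositions x ≡ false →
                      rank false minValues (π x) ≡ nth σ-list (rank false minPositions x)
    rank-nonMinimum x nonMin = begin
      rank false minValues (π x)                       ≡⟨ cong (λ y → rank false minValues (π y)) (sym i-th≡x) ⟩
      rank false minValues (π (nonMinimumPosition i))  ≡⟨ sym (toℕ-σ i) ⟩
      toℕ (σ i)                                        ≡⟨ cong toℕ (sym (lookup∘tabulate σ i)) ⟩
      toℕ (lookup (tabulate σ) i)                      ≡⟨ sym (nth-entries (tabulate σ) i) ⟩
      nth σ-list (toℕ i)                               ≡⟨ cong (nth σ-list) (Fin.toℕ-fromℕ< _) ⟩
      nth σ-list (rank false minPositions x)           ∎
      where
      open ≡-Reasoning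
      i = fromℕ< (rank<count false minPositions x nonMin)
      i-th≡x = select-rank false minPositions x nonMin

  module _ {N : ℕ} {p p' : Vec (Fin N) N} (p-perm : IsPerm p) (p'-perm : IsPerm p') where
    private
      module L  = LeftToRightMinima p  p-perm
      module L' = LeftToRightMinima p' p'-perm

    -- The value p' x is a minimum value of p, taken at some minimum z of p; z < x
    -- is excluded by injectivity of p', and z > x forces p z < p x.
    minimum-≤ : L.minValues ≡ L'.minValues → ∀ x → L'.IsMinimum x →
                (∀ y → y <ᶠ x → L.π y ≡ L'.π y) → L'.π x ≤ᶠ L.π x
    minimum-≤ values≡ x min' agree with lookup-indicator⁻ L.isMinimumValue? (L'.π x) (begin
        lookup L.minValues (L'.π x)   ≡⟨ cong (λ B → lookup B (L'.π x)) values≡ ⟩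
        lookup L'.minValues (L'.π x)  ≡⟨ L'.minValues-π x ⟩
        lookup L'.minPositions x      ≡⟨ lookup-indicator⁺ L'.isMinimum? min' ⟩
        true                          ∎)
      where open ≡-Reasoning
    ... | z , πz≡π'x , min-z with Fin.<-cmp z x
    ...   | tri< z<x _ _ = ⊥-elim (Fin.<⇒≢ z<x (p'-perm z x (trans (sym (agree z z<x)) πz≡π'x)))
    ...   | tri≈ _ refl _ = Fin.≤-reflexive (sym πz≡π'x)
    ...   | tri> _ _ x<z = ℕ.<⇒≤ (subst (_<ᶠ L.π x) πz≡π'x (min-z x x<z))

  module _ {N : ℕ} {p p' : Vec (Fin N) N} (p-perm : IsPerm p) (p'-perm : IsPerm p') where
    private
      module L  = LeftToRightMinima p  p-perm
      module L' = LeftToRightMinima p' p'-perm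

    code-injective : code p p-perm ≡ code p' p'-perm → p ≡ p'
    code-injective code≡ = begin
      p                     ≡⟨ sym (tabulate∘lookup p) ⟩
      tabulate (lookup p)   ≡⟨ tabulate-cong (All.wfRec <-wellFounded 0ℓ _ agree-at) ⟩
      tabulate (lookup p')  ≡⟨ tabulate∘lookup p' ⟩
      p'                    ∎
      where
      open ≡-Reasoning
      positions≡ : L'.minPositions ≡ L.minPositions
      positions≡ = sym (cong proj₁ code≡)
      values≡ : L.minValues ≡ L'.minValues
      values≡ = cong (λ c → proj₁ (proj₂ c)) code≡
      σ-lists≡ : σ-list p p-perm ≡ σ-list p' p'-perm
      σ-lists≡ = cong (λ c → proj₂ (proj₂ c)) code≡
      minPosition' : ∀ {x b} → lookup L.minPositions x ≡ b → lookup L'.minPositions x ≡ b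
      minPosition' {x} = trans (cong (λ A → lookup A x) positions≡)

      agree-at : ∀ x → (∀ {y} → y <ᶠ x → L.π y ≡ L'.π y) → L.π x ≡ L'.π x
      agree-at x below with lookup L.minPositions x in min?
      ... | true  = Fin.≤-antisym
        (minimum-≤ p'-perm p-perm (sym values≡) x (lookup-indicator⁻ L.isMinimum? x min?)
                   (λ y y<x → sym (below y<x)))
        (minimum-≤ p-perm p'-perm values≡ x (lookup-indicator⁻ L'.isMinimum? x (minPosition' min?))
                   (λ y y<x → below y<x))
      ... | false = rank-injective false L.minValues (trans (L.minValues-π x) min?)
        (trans (cong (λ B → lookup B (L'.π x)) values≡) (trans (L'.minValues-π x) (minPosition' min?)))
        (begin
          rank false L.minValues (L.π x)                          ≡⟨ rank-nonMinimum p p-perm x min? ⟩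
          nth (σ-list p p-perm) (rank false L.minPositions x)     ≡⟨ cong₂ (λ l A → nth l (rank false A x)) σ-lists≡ (sym positions≡) ⟩
          nth (σ-list p' p'-perm) (rank false L'.minPositions x)  ≡⟨ sym (rank-nonMinimum p' p'-perm x (minPosition' min?)) ⟩
          rank false L'.minValues (L'.π x)                        ≡⟨ cong (λ B → rank false B (L'.π x)) (sym values≡) ⟩
          rank false L.minValues (L'.π x)                         ∎)

module Enumeration where

  open import Data.Nat using (zero; suc; _≤_)
  open import Data.Fin using (zero; suc)
  import Data.Fin.Properties as Fin
  open import Data.Vec using (Vec; []; _∷_; lookup; tabulate)
  open import Data.Vec.Properties using (lookup∘tabulate; ∷-injective)
  open import Data.List as List using (List; []; _∷_; length; filter; cartesianProductWith; allFin)
  import Data.List.Properties as List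
  open import Data.List.Relation.Unary.Any as Any using (Any; here; there; any?)
  open import Data.List.Relation.Unary.All as All using ()
  open import Data.List.Relation.Unary.AllPairs using ([]; _∷_)
  open import Data.List.Relation.Unary.Unique.Propositional using (Unique)
  import Data.List.Relation.Unary.Unique.Propositional.Properties as Unique
  open import Data.List.Membership.Propositional using (_∈_)
  open import Data.List.Membership.Propositional.Properties
    using (∈-cartesianProductWith⁺; ∈-allFin; ∈-filter⁺; ∈-filter⁻; ∈-lookup)
  open import Data.List.Relation.Unary.Any.Properties using (lookup-index)
  open import Data.Product using (_×_; _,_; proj₁; proj₂)
  open import Data.Empty using (⊥-elim)
  open import Data.Refinement using (Refinement; _,_; value-injective)
  open import Data.Irrelevant using ([_])
  open import Function.Bundles using (_↔_; mk↔ₛ′; Inverse)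
  open import Data.List.Membership.Setoid.Properties using (index-injective)
  open import Relation.Binary.PropositionalEquality
  open import Relation.Nullary using (Dec)
  open import Relation.Nullary.Decidable using (_×-dec_; _→-dec_; ¬?; recompute; map′)
  open import Relation.Unary using (Decidable)
  open Occurrence

  vectors : ∀ {A : Set} → List A → (k : ℕ) → List (Vec A k)
  vectors xs zero    = [] ∷ []
  vectors xs (suc k) = cartesianProductWith _∷_ xs (vectors xs k)

  ∈-vectors : ∀ {A : Set} {xs : List A} → (∀ x → x ∈ xs) → ∀ {k} (v : Vec A k) → v ∈ vectors xs k
  ∈-vectors ∈xs []      = here refl
  ∈-vectors ∈xs (x ∷ v) = ∈-cartesianProductWith⁺ _∷_ (∈xs x) (∈-vectors ∈xs v)

  vectors-unique : ∀ {A : Set} {xs : List A} → Unique xs → ∀ k → Unique (vectors xs k)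
  vectors-unique u zero    = All.[] ∷ []
  vectors-unique u (suc k) = Unique.cartesianProductWith⁺ _∷_ ∷-injective u (vectors-unique u k)

  index-unique : ∀ {A : Set} {xs : List A} {x} → Unique xs → (x∈xs x∈xs' : x ∈ xs) →
                 Any.index x∈xs ≡ Any.index x∈xs'
  index-unique u         (here refl) (here refl) = refl
  index-unique (x∉ ∷ _)  (here refl) (there x∈) = ⊥-elim (All.lookup x∉ x∈ refl)
  index-unique (x∉ ∷ _)  (there x∈) (here refl) = ⊥-elim (All.lookup x∉ x∈ refl)
  index-unique (_ ∷ u)   (there x∈) (there x∈') = cong suc (index-unique u x∈ x∈')

  index-∈-lookup : ∀ {A : Set} (xs : List A) i → Any.index (∈-lookup {xs = xs} i) ≡ i
  index-∈-lookup (x ∷ xs) zero    = refl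
  index-∈-lookup (x ∷ xs) (suc i) = cong suc (index-∈-lookup xs i)

  filter-↔ : ∀ {A : Set} {P : A → Set} (P? : Decidable P) {xs : List A} →
             Unique xs → (∀ x → x ∈ xs) → Refinement A P ↔ Fin (length (filter P? xs))
  filter-↔ {A} {P} P? {xs} u ∈xs = mk↔ₛ′ to from to∘from from∘to
    where
    ys = filter P? xs
    ∈ys : ∀ x → P x → x ∈ ys
    ∈ys x px = ∈-filter⁺ P? (∈xs x) px
    to : Refinement A P → Fin (length ys)
    to (x , [ px ]) = Any.index (∈ys x (recompute (P? x) px))
    from : Fin (length ys) → Refinement A P
    from i = List.lookup ys i , [ proj₂ (∈-filter⁻ P? {xs = xs} (∈-lookup {xs = ys} i)) ]
    to∘from : ∀ i → to (from i) ≡ i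
    to∘from i = trans (index-unique (Unique.filter⁺ P? u) _ (∈-lookup {xs = ys} i)) (index-∈-lookup ys i)
    from∘to : ∀ r → from (to r) ≡ r
    from∘to (x , [ px ]) = value-injective (sym (lookup-index (∈ys x (recompute (P? x) px))))

  ↔-injection⇒≤-length : ∀ {A B : Set} {m} {xs : List B} → A ↔ Fin m → (f : A → B) →
                          (∀ {x y} → f x ≡ f y → x ≡ y) → (∀ x → f x ∈ xs) → m ≤ length xs
  ↔-injection⇒≤-length {B = B} A↔m f f-injective f∈xs = Fin.injective⇒≤ {f = g} g-injective
    where
    open Inverse A↔m
    g : Fin _ → Fin _
    g i = Any.index (f∈xs (from i))
    g-injective : ∀ {i j} → g i ≡ g j → i ≡ j
    g-injective {i} {j} eq = begin
      i              ≡⟨ sym (strictlyInverseˡ i) ⟩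
      to (from i)    ≡⟨ cong to (f-injective (index-injective (setoid B) (f∈xs (from i)) (f∈xs (from j)) eq)) ⟩
      to (from j)    ≡⟨ strictlyInverseˡ j ⟩
      j              ∎
      where open ≡-Reasoning

  contains? : ∀ {n k} (p : Vec (Fin n) n) (q : Vec (Fin k) k) → Dec (Contains p q)
  contains? {n} {k} p q =
    map′ from-vector to-vector (any? (λ e → isOccurrence? (lookup p) q (lookup e)) (vectors (allFin n) k))
    where
    from-vector : Any (λ e → IsOccurrence (lookup p) q (lookup e)) (vectors (allFin n) k) → Contains p q
    from-vector any = lookup (proj₁ (Any.satisfied any)) , proj₂ (Any.satisfied any)
    to-vector : Contains p q → Any (λ e → IsOccurrence (lookup p) q (lookup e)) (vectors (allFin n) k)
    to-vector (e , occurrence) =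
      Any.map (λ { refl → IsOccurrence-resp-≗ {w = lookup p} {q = q} (λ a → sym (lookup∘tabulate e a)) occurrence })
              (∈-vectors ∈-allFin (tabulate e))

  isPerm? : ∀ {n} (p : Vec (Fin n) n) → Dec (IsPerm p)
  isPerm? p = Fin.all? λ i → Fin.all? λ j → (lookup p i Fin.≟ lookup p j) →-dec (i Fin.≟ j)

  module _ {k : ℕ} (q : Vec (Fin k) k) where

    isAvoider? : ∀ {n} (p : Vec (Fin n) n) → Dec (IsPerm p × Avoids p q)
    isAvoider? p = isPerm? p ×-dec ¬? (contains? p q)

    avoiders : (n : ℕ) → List (Vec (Fin n) n)
    avoiders n = filter isAvoider? (vectors (allFin n) n)

    avoiders-count : ∀ n → HasCount n q (length (avoiders n))
    avoiders-count n = filter-↔ isAvoider? (vectors-unique (Unique.allFin⁺ n) n) (∈-vectors ∈-allFin)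

    ∈-avoiders : ∀ {n} (p : Vec (Fin n) n) → IsPerm p → Avoids p q → p ∈ avoiders n
    ∈-avoiders p p-perm p-avoids = ∈-filter⁺ isAvoider? (∈-vectors ∈-allFin p) (p-perm , p-avoids)

    length-avoiders-0 : length (avoiders 0) ≤ 1
    length-avoiders-0 = List.length-filter isAvoider? (vectors (allFin 0) 0)

module Encoding {k : ℕ} (q : Vec (Fin (suc k)) (suc k)) where

  open import Data.Bool using (Bool; true; false)
  open import Data.Nat using (_≤_)
  import Data.Nat.Properties as ℕ
  open import Data.Vec using (tabulate)
  open import Data.List as List using (List; []; _∷_; length; concatMap)
  open import Data.List.Relation.Unary.Any using (here; there)
  open import Data.List.Membership.Propositional using (_∈_)
  open import Data.List.Membership.Propositional.Properties using (∈-concat⁺′; ∈-map⁺)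
  open import Data.Product using (_×_; _,_; proj₁; proj₂)
  open import Data.Empty using (⊥-elim)
  open import Data.Refinement using (_,_; value; value-injective)
  open import Data.Irrelevant using ([_])
  open import Relation.Binary.PropositionalEquality
  open import Relation.Nullary using (Dec; yes; no)
  open import Relation.Nullary.Decidable using (recompute)
  open BitVector
  open Enumeration
  open Reconstruction

  bitVectors : (N : ℕ) → List (Vec Bool N)
  bitVectors = vectors (true ∷ false ∷ [])

  ∈-bitVectors : ∀ {N} (A : Vec Bool N) → A ∈ bitVectors N
  ∈-bitVectors = ∈-vectors λ { true → here refl ; false → there (here refl) }

  onlyIf : ∀ {X Y : Set} → Dec X → List Y → List Y
  onlyIf (yes _) ys = ys
  onlyIf (no _)  _  = []

  ∈-onlyIf : ∀ {X Y : Set} (X? : Dec X) → X → ∀ {y : Y} {ys} → y ∈ ys → y ∈ onlyIf X? ys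
  ∈-onlyIf (yes _) _ y∈ys = y∈ys
  ∈-onlyIf (no ¬x) x _    = ⊥-elim (¬x x)

  codesWith : ∀ {N} (A B : Vec Bool N) → List (Code N)
  codesWith A B = List.map (λ σ → A , B , entries σ) (avoiders q (count false A))

  codeBlock : ∀ {N} (A B : Vec Bool N) → List (Code N)
  codeBlock A B = onlyIf (count false A ℕ.≟ count false B) (codesWith A B)

  codes : (N : ℕ) → List (Code N)
  codes N = concatMap (λ A → concatMap (codeBlock A) (bitVectors N)) (bitVectors N)

  module _ (q-perm : IsPerm q) (q-head : head q ≡ zero) {N : ℕ} where

    code-∈-codes : (p : Vec (Fin N) N) (p-perm : IsPerm p) → Avoids p (extend q) → code p p-perm ∈ codes N
    code-∈-codes p p-perm p-avoids =
      ∈-concat⁺′ (∈-concat⁺′ ∈-block (∈-map⁺ (codeBlock minPositions) (∈-bitVectors minValues)))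
                 (∈-map⁺ _ (∈-bitVectors minPositions))
      where
      open LeftToRightMinima p p-perm
      ∈-block : code p p-perm ∈ codeBlock minPositions minValues
      ∈-block = ∈-onlyIf (count false minPositions ℕ.≟ count false minValues) count-nonMinimumValues
        (∈-map⁺ _ (∈-avoiders q (tabulate σ) σ-perm (σ-avoids q q-perm q-head p-avoids)))

    avoider-proof : (r : Avoiders N (extend q)) → IsPerm (value r) × Avoids (value r) (extend q)
    avoider-proof (p , [ pf ]) = recompute (isAvoider? (extend q) p) pf

    encode : Avoiders N (extend q) → Code N
    encode r = code (value r) (proj₁ (avoider-proof r))

    count≤length-codes : ∀ {m} → HasCount N (extend q) m → m ≤ length (codes N)
    count≤length-codes count = ↔-injection⇒≤-length count encode
      (λ {r} {r'} eq → value-injective (code-injective (proj₁ (avoider-proof r)) (proj₁ (avoider-proof r')) eq))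
      (λ r → code-∈-codes (value r) _ (proj₂ (avoider-proof r)))

module RationalArithmetic where

  open import Data.Nat as ℕ using (zero; suc)
  import Data.Nat.Properties as ℕ
  open import Data.Nat.Coprimality using (1-coprimeTo; sym)
  open import Data.Integer as ℤ using (-[1+_])
  import Data.Integer.Properties as ℤ
  open import Data.Rational using (ℚ; mkℚ; _/_; _+_; _*_; _≤_; _<_; 0ℚ; 1ℚ; *<*; nonNegative; positive)
  import Data.Rational.Properties as ℚ
  open import Data.Rational.Solver using (module +-*-Solver)
  open import Data.List as List using (List; []; _∷_; _++_; length; concatMap)
  import Data.List.Properties as List
  open import Data.Product using (∃; _,_)
  open import Relation.Binary.PropositionalEquality hiding (sym)
  import Relation.Binary.PropositionalEquality as ≡

  ℕ→ℚ≡mkℚ : ∀ k → ℕ→ℚ k ≡ mkℚ (ℤ.+ k) 0 (sym (1-coprimeTo k))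
  ℕ→ℚ≡mkℚ k = ℚ.normalize-coprime (sym (1-coprimeTo k))

  ℕ→ℚ-+ : ∀ a b → ℕ→ℚ (a ℕ.+ b) ≡ ℕ→ℚ a + ℕ→ℚ b
  ℕ→ℚ-+ a b = ≡.sym (trans (cong₂ _+_ (ℕ→ℚ≡mkℚ a) (ℕ→ℚ≡mkℚ b)) (cong (_/ 1) numerator))
    where
    numerator : ℤ.+ a ℤ.* ℤ.+ 1 ℤ.+ ℤ.+ b ℤ.* ℤ.+ 1 ≡ ℤ.+ (a ℕ.+ b)
    numerator = trans (cong₂ ℤ._+_ (ℤ.*-identityʳ (ℤ.+ a)) (ℤ.*-identityʳ (ℤ.+ b))) (≡.sym (ℤ.pos-+ a b))

  0≤ℕ→ℚ : ∀ k → 0ℚ ≤ ℕ→ℚ k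
  0≤ℕ→ℚ k = ℚ.nonNegative⁻¹ _ {{ℚ.normalize-nonNeg k 1}}

  ℕ→ℚ-mono-≤ : ∀ {a b} → a ℕ.≤ b → ℕ→ℚ a ≤ ℕ→ℚ b
  ℕ→ℚ-mono-≤ {a} {b} a≤b = begin
    ℕ→ℚ a                      ≡⟨ ≡.sym (ℚ.+-identityʳ _) ⟩
    ℕ→ℚ a + 0ℚ                 ≤⟨ ℚ.+-monoʳ-≤ (ℕ→ℚ a) (0≤ℕ→ℚ (b ℕ.∸ a)) ⟩
    ℕ→ℚ a + ℕ→ℚ (b ℕ.∸ a)      ≡⟨ ≡.sym (ℕ→ℚ-+ a (b ℕ.∸ a)) ⟩
    ℕ→ℚ (a ℕ.+ (b ℕ.∸ a))      ≡⟨ cong ℕ→ℚ (ℕ.m+[n∸m]≡n a≤b) ⟩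
    ℕ→ℚ b                      ∎
    where open ℚ.≤-Reasoning

  archimedean : ∀ x → ∃ λ M → x < ℕ→ℚ M
  archimedean (mkℚ (ℤ.+ m) d c) = suc m , subst (mkℚ (ℤ.+ m) d c <_) (≡.sym (ℕ→ℚ≡mkℚ (suc m))) (*<* m<[1+m][1+d])
    where
    m<[1+m][1+d] : ℤ.+ m ℤ.* ℤ.+ 1 ℤ.< ℤ.+ suc m ℤ.* ℤ.+ suc d
    m<[1+m][1+d] = subst₂ ℤ._<_ (≡.sym (ℤ.*-identityʳ (ℤ.+ m))) (ℤ.pos-* (suc m) (suc d))
                          (ℤ.+<+ (ℕ.m≤m*n (suc m) (suc d)))
  archimedean (mkℚ -[1+ m ] d c) = 0 , subst (mkℚ -[1+ m ] d c <_) (≡.sym (ℕ→ℚ≡mkℚ 0)) (*<* neg<0)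
    where
    neg<0 : -[1+ m ] ℤ.* ℤ.+ 1 ℤ.< ℤ.+ 0 ℤ.* ℤ.+ suc d
    neg<0 = subst (ℤ._< ℤ.+ 0 ℤ.* ℤ.+ suc d) (≡.sym (ℤ.*-identityʳ -[1+ m ])) ℤ.-<+

  0≤+ : ∀ {x y} → 0ℚ ≤ x → 0ℚ ≤ y → 0ℚ ≤ x + y
  0≤+ {x} {y} 0≤x 0≤y = subst (_≤ x + y) (ℚ.+-identityˡ 0ℚ) (ℚ.+-mono-≤ 0≤x 0≤y)

  0≤* : ∀ {x y} → 0ℚ ≤ x → 0ℚ ≤ y → 0ℚ ≤ x * y
  0≤* {x} {y} 0≤x 0≤y =
    ℚ.nonNegative⁻¹ _ {{ℚ.nonNeg*nonNeg⇒nonNeg x {{nonNegative 0≤x}} y {{nonNegative 0≤y}}}}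

  *-mono-≤ : ∀ {x y u v} → 0ℚ ≤ x → 0ℚ ≤ v → x ≤ y → u ≤ v → x * u ≤ y * v
  *-mono-≤ {x} {y} {u} {v} 0≤x 0≤v x≤y u≤v = ℚ.≤-trans
    (ℚ.*-monoˡ-≤-nonNeg x {{nonNegative 0≤x}} u≤v) (ℚ.*-monoʳ-≤-nonNeg v {{nonNegative 0≤v}} x≤y)

  0≤^ℚ : ∀ {x} → 0ℚ ≤ x → ∀ n → 0ℚ ≤ x ^ℚ n
  0≤^ℚ 0≤x zero    = ℚ.nonNegative⁻¹ 1ℚ
  0≤^ℚ 0≤x (suc n) = 0≤* 0≤x (0≤^ℚ 0≤x n)

  ^ℚ-monoˡ-≤ : ∀ {x y} → 0ℚ ≤ x → x ≤ y → ∀ n → x ^ℚ n ≤ y ^ℚ n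
  ^ℚ-monoˡ-≤ 0≤x x≤y zero    = ℚ.≤-refl
  ^ℚ-monoˡ-≤ 0≤x x≤y (suc n) = *-mono-≤ 0≤x (0≤^ℚ (ℚ.≤-trans 0≤x x≤y) n) x≤y (^ℚ-monoˡ-≤ 0≤x x≤y n)

  0<^ℚ : ∀ {y} → 0ℚ < y → ∀ n → 0ℚ < y ^ℚ n
  0<^ℚ 0<y zero    = ℚ.positive⁻¹ 1ℚ
  0<^ℚ {y} 0<y (suc n) =
    ℚ.positive⁻¹ _ {{ℚ.pos*pos⇒pos y {{positive 0<y}} (y ^ℚ n) {{positive (0<^ℚ 0<y n)}}}}

  ^ℚ-monoˡ-< : ∀ {x y} → 0ℚ ≤ x → x < y → ∀ n → x ^ℚ suc n < y ^ℚ suc n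
  ^ℚ-monoˡ-< {x} {y} 0≤x x<y n = ℚ.≤-<-trans
    (ℚ.*-monoˡ-≤-nonNeg x {{nonNegative 0≤x}} (^ℚ-monoˡ-≤ 0≤x (ℚ.<⇒≤ x<y) n))
    (ℚ.*-monoˡ-<-pos (y ^ℚ n) {{positive (0<^ℚ (ℚ.≤-<-trans 0≤x x<y) n)}} x<y)

  ^ℚ-distribˡ-+-* : ∀ x m n → x ^ℚ (m ℕ.+ n) ≡ (x ^ℚ m) * (x ^ℚ n)
  ^ℚ-distribˡ-+-* x zero    n = ≡.sym (ℚ.*-identityˡ _)
  ^ℚ-distribˡ-+-* x (suc m) n = trans (cong (x *_) (^ℚ-distribˡ-+-* x m n)) (≡.sym (ℚ.*-assoc x _ _))

  ^ℚ-distribʳ-* : ∀ x y n → (x * y) ^ℚ n ≡ (x ^ℚ n) * (y ^ℚ n)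
  ^ℚ-distribʳ-* x y zero    = refl
  ^ℚ-distribʳ-* x y (suc n) = trans (cong ((x * y) *_) (^ℚ-distribʳ-* x y n)) (interchange x y (x ^ℚ n) (y ^ℚ n))
    where
    open +-*-Solver
    interchange : ∀ a b c d → (a * b) * (c * d) ≡ (a * c) * (b * d)
    interchange = solve 4 (λ a b c d → (a :* b) :* (c :* d) := (a :* c) :* (b :* d)) refl

  sumOver : ∀ {A : Set} → (A → ℚ) → List A → ℚ
  sumOver f []       = 0ℚ
  sumOver f (x ∷ xs) = f x + sumOver f xs

  sumOver-++ : ∀ {A : Set} (f : A → ℚ) xs ys → sumOver f (xs ++ ys) ≡ sumOver f xs + sumOver f ys
  sumOver-++ f []       ys = ≡.sym (ℚ.+-identityˡ _)
  sumOver-++ f (x ∷ xs) ys = trans (cong (f x +_) (sumOver-++ f xs ys)) (≡.sym (ℚ.+-assoc (f x) _ _))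

  sumOver-map : ∀ {A B : Set} (f : B → ℚ) (g : A → B) xs → sumOver f (List.map g xs) ≡ sumOver (λ x → f (g x)) xs
  sumOver-map f g []       = refl
  sumOver-map f g (x ∷ xs) = cong (f (g x) +_) (sumOver-map f g xs)

  sumOver-*ˡ : ∀ {A : Set} c (f : A → ℚ) xs → sumOver (λ x → c * f x) xs ≡ c * sumOver f xs
  sumOver-*ˡ c f []       = ≡.sym (ℚ.*-zeroʳ c)
  sumOver-*ˡ c f (x ∷ xs) = trans (cong (c * f x +_) (sumOver-*ˡ c f xs)) (≡.sym (ℚ.*-distribˡ-+ c (f x) _))

  sumOver-*ʳ : ∀ {A : Set} c (f : A → ℚ) xs → sumOver (λ x → f x * c) xs ≡ sumOver f xs * c
  sumOver-*ʳ c f []       = ≡.sym (ℚ.*-zeroˡ c)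
  sumOver-*ʳ c f (x ∷ xs) = trans (cong (f x * c +_) (sumOver-*ʳ c f xs)) (≡.sym (ℚ.*-distribʳ-+ c (f x) _))

  length-concatMap-≤ : ∀ {A B : Set} (f : A → List B) (g : A → ℚ) → (∀ x → ℕ→ℚ (length (f x)) ≤ g x) →
                       ∀ xs → ℕ→ℚ (length (concatMap f xs)) ≤ sumOver g xs
  length-concatMap-≤ f g f≤g []       = ℚ.≤-refl
  length-concatMap-≤ f g f≤g (x ∷ xs) = begin
    ℕ→ℚ (length (f x ++ concatMap f xs))                   ≡⟨ cong ℕ→ℚ (List.length-++ (f x)) ⟩
    ℕ→ℚ (length (f x) ℕ.+ length (concatMap f xs))         ≡⟨ ℕ→ℚ-+ (length (f x)) _ ⟩
    ℕ→ℚ (length (f x)) + ℕ→ℚ (length (concatMap f xs))     ≤⟨ ℚ.+-mono-≤ (f≤g x) (length-concatMap-≤ f g f≤g xs) ⟩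
    g x + sumOver g xs                                      ∎
    where open ℚ.≤-Reasoning

module Squares where

  open import Data.Nat using (zero; suc)
  open import Data.Rational using (ℚ; _+_; _*_; _-_; -_; 1/_; _≤_; _<_; 0ℚ; 1ℚ; NonZero; nonNegative; positive)
  import Data.Rational.Properties as ℚ
  open import Data.Rational.Solver using (module +-*-Solver)
  open import Data.Product using (∃; _×_; _,_)
  open import Data.Sum using (inj₁; inj₂)
  open import Data.Empty using (⊥-elim)
  open import Relation.Binary.PropositionalEquality
  open import Relation.Nullary using (¬_; Dec; yes; no)
  open +-*-Solver
  open RationalArithmetic

  x+1-x≡1 : ∀ x → x + 1ℚ - x ≡ 1ℚ
  x+1-x≡1 = solve 1 (λ x → x :+ con 1ℚ :- x := con 1ℚ) refl

  x+[y-x]≡y : ∀ x y → x + (y - x) ≡ y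
  x+[y-x]≡y = solve 2 (λ x y → x :+ (y :- x) := y) refl

  x*[y*z]≡y*[x*z] : ∀ x y z → x * (y * z) ≡ y * (x * z)
  x*[y*z]≡y*[x*z] = solve 3 (λ x y z → x :* (y :* z) := y :* (x :* z)) refl

  [1+x]*y≡x*y+y : ∀ x y → (1ℚ + x) * y ≡ x * y + y
  [1+x]*y≡x*y+y = solve 2 (λ x y → (con 1ℚ :+ x) :* y := x :* y :+ y) refl

  [x+y]²≡x²+[x+x+y]*y : ∀ x y → (x + y) * (x + y) ≡ x * x + (x + x + y) * y
  [x+y]²≡x²+[x+x+y]*y = solve 2 (λ x y → (x :+ y) :* (x :+ y) := x :* x :+ (x :+ x :+ y) :* y) refl

  x+1+[x+1]+1≡x+x+3 : ∀ x → x + 1ℚ + (x + 1ℚ) + 1ℚ ≡ x + x + 1ℚ + 1ℚ + 1ℚ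
  x+1+[x+1]+1≡x+x+3 = solve 1 (λ x → x :+ con 1ℚ :+ (x :+ con 1ℚ) :+ con 1ℚ := x :+ x :+ con 1ℚ :+ con 1ℚ :+ con 1ℚ) refl

  x<x+1 : ∀ x → x < x + 1ℚ
  x<x+1 x = subst (_< x + 1ℚ) (ℚ.+-identityʳ x) (ℚ.+-monoʳ-< x (ℚ.positive⁻¹ 1ℚ))

  1≤x+1 : ∀ {x} → 0ℚ ≤ x → 1ℚ ≤ x + 1ℚ
  1≤x+1 {x} 0≤x = subst (_≤ x + 1ℚ) (ℚ.+-identityˡ 1ℚ) (ℚ.+-monoˡ-≤ 1ℚ 0≤x)

  <-square : ∀ {a y} → 0ℚ ≤ a → a + 1ℚ ≤ y → a < y * y
  <-square {a} {y} 0≤a a+1≤y = ℚ.<-≤-trans (x<x+1 a) (begin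
    a + 1ℚ             ≡⟨ sym (ℚ.*-identityʳ (a + 1ℚ)) ⟩
    (a + 1ℚ) * 1ℚ      ≤⟨ *-mono-≤ 0≤a+1 (ℚ.≤-trans 0≤a+1 a+1≤y) a+1≤y 1≤y ⟩
    y * y              ∎)
    where
    open ℚ.≤-Reasoning
    0≤a+1 = ℚ.≤-trans (ℚ.nonNegative⁻¹ 1ℚ) (1≤x+1 0≤a)
    1≤y   = ℚ.≤-trans (1≤x+1 0≤a) a+1≤y

  ≤-of-square≤ : ∀ {a x} → 0ℚ ≤ a → x * x ≤ a → x ≤ a + 1ℚ
  ≤-of-square≤ 0≤a x²≤a = ℚ.≮⇒≥ λ a+1<x →
    ℚ.<-irrefl refl (ℚ.<-≤-trans (<-square 0≤a (ℚ.<⇒≤ a+1<x)) x²≤a)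

  <-of-square< : ∀ {x y} → 0ℚ ≤ y → x * x < y * y → x < y
  <-of-square< 0≤y x²<y² = ℚ.≰⇒> λ y≤x →
    ℚ.<-irrefl refl (ℚ.<-≤-trans x²<y² (*-mono-≤ 0≤y (ℚ.≤-trans 0≤y y≤x) y≤x y≤x))

  first-crossing : (P : ℕ → Set) → (∀ i → Dec (P i)) → ¬ P 0 → ∀ M → P M → ∃ λ j → ¬ P j × P (suc j)
  first-crossing P P? ¬P0 zero    PM = ⊥-elim (¬P0 PM)
  first-crossing P P? ¬P0 (suc M) PM with P? M
  ... | yes PM' = first-crossing P P? ¬P0 M PM'
  ... | no ¬PM' = M , ¬PM' , PM

  SquareBetween : ℚ → ℚ → Set
  SquareBetween a b = ∃ λ s → 0ℚ ≤ s × a < s * s × s * s < b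

  SquareBetween-weakenʳ : ∀ {a b b'} → b ≤ b' → SquareBetween a b → SquareBetween a b'
  SquareBetween-weakenʳ b≤b' (s , 0≤s , a<s² , s²<b) = s , 0≤s , a<s² , ℚ.<-≤-trans s²<b b≤b'

  fine-step : ∀ {a b} → 0ℚ ≤ a → a < b → b ≤ a + 1ℚ →
              ∃ λ h → 0ℚ < h × h ≤ 1ℚ × (a + a + 1ℚ + 1ℚ + 1ℚ) * h < b - a
  fine-step {a} {b} 0≤a a<b b≤a+1 = h , 0<h , h≤1 , E*h<d
    where
    open ℚ.≤-Reasoning
    d = b - a
    E = a + a + 1ℚ + 1ℚ + 1ℚ
    D = E + 1ℚ

    0<d : 0ℚ < d
    0<d = subst (_< d) (ℚ.+-inverseʳ a) (ℚ.+-monoˡ-< (- a) a<b)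

    d≤1 : d ≤ 1ℚ
    d≤1 = ℚ.≤-trans (ℚ.+-monoˡ-≤ (- a) b≤a+1) (ℚ.≤-reflexive (x+1-x≡1 a))

    0≤E : 0ℚ ≤ E
    0≤E = 0≤+ (0≤+ (0≤+ (0≤+ 0≤a 0≤a) 0≤1) 0≤1) 0≤1
      where 0≤1 = ℚ.nonNegative⁻¹ 1ℚ

    0<D : 0ℚ < D
    0<D = ℚ.<-≤-trans (ℚ.positive⁻¹ 1ℚ) (1≤x+1 0≤E)

    instance
      D≢0 : NonZero D
      D≢0 = ℚ.pos⇒nonZero D {{positive 0<D}}

    h = d * 1/ D

    0<h : 0ℚ < h
    0<h = ℚ.positive⁻¹ _ {{ℚ.pos*pos⇒pos d {{positive 0<d}} (1/ D) {{ℚ.1/pos⇒pos D {{positive 0<D}}}}}}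

    D*h≡d : D * h ≡ d
    D*h≡d = begin-equality
      D * (d * 1/ D)   ≡⟨ x*[y*z]≡y*[x*z] D d (1/ D) ⟩
      d * (D * 1/ D)   ≡⟨ cong (d *_) (ℚ.*-inverseʳ D) ⟩
      d * 1ℚ           ≡⟨ ℚ.*-identityʳ d ⟩
      d                ∎

    E*h<d : E * h < d
    E*h<d = subst (E * h <_) D*h≡d (ℚ.*-monoˡ-<-pos h {{positive 0<h}} (x<x+1 E))

    h≤1 : h ≤ 1ℚ
    h≤1 = begin
      h          ≡⟨ sym (ℚ.*-identityˡ h) ⟩
      1ℚ * h     ≤⟨ ℚ.*-monoʳ-≤-nonNeg h {{nonNegative (ℚ.<⇒≤ 0<h)}} (1≤x+1 0≤E) ⟩
      D * h      ≡⟨ D*h≡d ⟩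
      d          ≤⟨ d≤1 ⟩
      1ℚ         ∎

  crossing-multiple : ∀ {a h} → 0ℚ ≤ a → 0ℚ < h →
                      ∃ λ j → (ℕ→ℚ j * h) * (ℕ→ℚ j * h) ≤ a × a < (ℕ→ℚ (suc j) * h) * (ℕ→ℚ (suc j) * h)
  crossing-multiple {a} {h} 0≤a 0<h =
    let (M , M-bound) = archimedean ((a + 1ℚ) * 1/ h)
        (j , ¬Above-j , Above-j+1) = first-crossing Above (λ i → a ℚ.<? _) ¬Above0 M (AboveM M M-bound)
    in j , ℚ.≮⇒≥ ¬Above-j , Above-j+1
    where
    instance
      h≢0 : NonZero h
      h≢0 = ℚ.pos⇒nonZero h {{positive 0<h}}
    Above : ℕ → Set
    Above i = a < (ℕ→ℚ i * h) * (ℕ→ℚ i * h)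
    ¬Above0 : ¬ Above 0
    ¬Above0 a<0 = ℚ.<-irrefl refl (ℚ.<-≤-trans (subst (a <_) 0*h*[0*h]≡0 a<0) 0≤a)
      where 0*h*[0*h]≡0 = trans (cong (_* (0ℚ * h)) (ℚ.*-zeroˡ h)) (ℚ.*-zeroˡ (0ℚ * h))
    AboveM : ∀ M → (a + 1ℚ) * 1/ h < ℕ→ℚ M → Above M
    AboveM M M-bound = <-square 0≤a (begin
      a + 1ℚ                  ≡⟨ sym (ℚ.*-identityʳ _) ⟩
      (a + 1ℚ) * 1ℚ           ≡⟨ cong ((a + 1ℚ) *_) (sym (ℚ.*-inverseˡ h)) ⟩
      (a + 1ℚ) * (1/ h * h)   ≡⟨ sym (ℚ.*-assoc (a + 1ℚ) (1/ h) h) ⟩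
      (a + 1ℚ) * 1/ h * h     <⟨ ℚ.*-monoˡ-<-pos h {{positive 0<h}} M-bound ⟩
      ℕ→ℚ M * h               ∎)
      where open ℚ.≤-Reasoning

  -- Let s be the first multiple of h with s² > a. Then (s - h)² ≤ a forces
  -- s - h ≤ a + 1, so s² = (s - h)² + (2(s - h) + h) h ≤ a + (2a + 3) h < b.
  square-on-grid : ∀ {a b} → 0ℚ ≤ a → (∃ λ h → 0ℚ < h × h ≤ 1ℚ × (a + a + 1ℚ + 1ℚ + 1ℚ) * h < b - a) →
                   SquareBetween a b
  square-on-grid {a} {b} 0≤a (h , 0<h , h≤1 , E*h<b-a) =
    let (j , x²≤a , a<s²) = crossing-multiple 0≤a 0<h
        x = ℕ→ℚ j * h
        s = ℕ→ℚ (suc j) * h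
        s≡x+h : s ≡ x + h
        s≡x+h = trans (cong (_* h) (ℕ→ℚ-+ 1 j)) ([1+x]*y≡x*y+y (ℕ→ℚ j) h)
        x≤a+1 : x ≤ a + 1ℚ
        x≤a+1 = ≤-of-square≤ 0≤a x²≤a
        x+x+h≤E : x + x + h ≤ a + a + 1ℚ + 1ℚ + 1ℚ
        x+x+h≤E = ℚ.≤-trans (ℚ.+-mono-≤ (ℚ.+-mono-≤ x≤a+1 x≤a+1) h≤1) (ℚ.≤-reflexive (x+1+[x+1]+1≡x+x+3 a))
        s²≡ : s * s ≡ x * x + (x + x + h) * h
        s²≡ = trans (cong (λ y → y * y) s≡x+h) ([x+y]²≡x²+[x+x+y]*y x h)
        s²<b : s * s < b
        s²<b = subst₂ _<_ (sym s²≡) (x+[y-x]≡y a b)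
          (ℚ.≤-<-trans (ℚ.+-mono-≤ x²≤a (ℚ.*-monoʳ-≤-nonNeg h {{nonNegative (ℚ.<⇒≤ 0<h)}} x+x+h≤E))
                       (ℚ.+-monoʳ-< a E*h<b-a))
    in s , 0≤* (0≤ℕ→ℚ (suc j)) (ℚ.<⇒≤ 0<h) , a<s² , s²<b

  square-between : ∀ {a b} → 0ℚ ≤ a → a < b → SquareBetween a b
  square-between {a} {b} 0≤a a<b with ℚ.≤-total b (a + 1ℚ)
  ... | inj₁ b≤a+1 = square-on-grid 0≤a (fine-step 0≤a a<b b≤a+1)
  ... | inj₂ a+1≤b = SquareBetween-weakenʳ a+1≤b (square-on-grid 0≤a (fine-step 0≤a (x<x+1 a) ℚ.≤-refl))

module CodeCount {k : ℕ} (q : Vec (Fin (suc k)) (suc k)) where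

  open import Data.Bool using (Bool; true; false)
  open import Data.Nat as ℕ using (zero; suc)
  import Data.Nat.Properties as ℕ
  open import Data.Rational using (ℚ; _+_; _*_; _≤_; 0ℚ; 1ℚ)
  import Data.Rational.Properties as ℚ
  open import Data.Rational.Solver using (module +-*-Solver)
  open import Data.Vec using (_∷_)
  open import Data.List as List using (List; []; _∷_; _++_; length; concatMap)
  import Data.List.Properties as List
  open import Data.Product using (_,_)
  open import Relation.Binary.PropositionalEquality
  open import Relation.Nullary using (Dec; yes; no)
  open BitVector
  open Enumeration using (avoiders)
  open Reconstruction using (Code; entries)
  open Encoding q
  open RationalArithmetic

  x+[y*x+0]≡[1+y]*x : ∀ x y → x + (y * x + 0ℚ) ≡ (1ℚ + y) * x
  x+[y*x+0]≡[1+y]*x = solve 2 (λ x y → x :+ (y :* x :+ con 0ℚ) := (con 1ℚ :+ y) :* x) refl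
    where open +-*-Solver

  length-onlyIf-≤ : ∀ {X Y : Set} (X? : Dec X) (ys : List Y) {c : ℚ} →
                    (X → ℕ→ℚ (length ys) ≤ c) → 0ℚ ≤ c → ℕ→ℚ (length (onlyIf X? ys)) ≤ c
  length-onlyIf-≤ (yes x) ys ys≤c _   = ys≤c x
  length-onlyIf-≤ (no _)  ys _    0≤c = 0≤c

  module _ {s : ℚ} (0≤s : 0ℚ ≤ s) where

    weight : ∀ {N} → Vec Bool N → ℚ
    weight A = s ^ℚ count false A

    0≤weight : ∀ {N} (A : Vec Bool N) → 0ℚ ≤ weight A
    0≤weight A = 0≤^ℚ 0≤s (count false A)

    sum-weight : ∀ N → sumOver weight (bitVectors N) ≡ (1ℚ + s) ^ℚ N
    sum-weight zero    = ℚ.+-identityʳ 1ℚ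
    sum-weight (suc N) = begin
      sumOver weight (T ++ (F ++ []))              ≡⟨ sumOver-++ weight T (F ++ []) ⟩
      sumOver weight T + sumOver weight (F ++ [])  ≡⟨ cong (sumOver weight T +_) (sumOver-++ weight F []) ⟩
      sumOver weight T + (sumOver weight F + 0ℚ)   ≡⟨ cong₂ (λ x y → x + (y + 0ℚ)) (sumOver-map weight (true ∷_) As) weight-F ⟩
      W + (s * W + 0ℚ)                             ≡⟨ x+[y*x+0]≡[1+y]*x W s ⟩
      (1ℚ + s) * W                                 ≡⟨ cong ((1ℚ + s) *_) (sum-weight N) ⟩
      (1ℚ + s) ^ℚ suc N                            ∎
      where
      open ≡-Reasoning
      As = bitVectors N
      T = List.map (true ∷_) As
      F = List.map (false ∷_) As
      W = sumOver weight As
      weight-F : sumOver weight F ≡ s * W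
      weight-F = trans (sumOver-map weight (false ∷_) As) (sumOver-*ˡ s weight As)

    module _ (N : ℕ) (avoiders-bound : ∀ t → t ℕ.≤ N → ℕ→ℚ (length (avoiders q t)) ≤ (s * s) ^ℚ t) where

      length-codeBlock-≤ : (A B : Vec Bool N) → ℕ→ℚ (length (codeBlock A B)) ≤ weight A * weight B
      length-codeBlock-≤ A B =
        length-onlyIf-≤ (count false A ℕ.≟ count false B) (codesWith A B) same-count (0≤* (0≤weight A) (0≤weight B))
        where
        open ℚ.≤-Reasoning
        t = count false A
        t≤N : t ℕ.≤ N
        t≤N = subst (t ℕ.≤_) (count-true+count-false A) (ℕ.m≤n+m t (count true A))
        same-count : t ≡ count false B → ℕ→ℚ (length (codesWith A B)) ≤ weight A * weight B
        same-count tA≡tB = begin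
          ℕ→ℚ (length (codesWith A B))             ≡⟨ cong ℕ→ℚ (List.length-map (λ σ → A , B , entries σ) (avoiders q t)) ⟩
          ℕ→ℚ (length (avoiders q t))               ≤⟨ avoiders-bound t t≤N ⟩
          (s * s) ^ℚ t                              ≡⟨ ^ℚ-distribʳ-* s s t ⟩
          s ^ℚ t * s ^ℚ t                           ≡⟨ cong (λ u → s ^ℚ t * s ^ℚ u) tA≡tB ⟩
          weight A * weight B                       ∎

      length-codes-≤ : ℕ→ℚ (length (codes N)) ≤ (1ℚ + s) ^ℚ (N ℕ.+ N)
      length-codes-≤ = begin
        ℕ→ℚ (length (codes N))
          ≤⟨ length-concatMap-≤ row (λ A → weight A * W) length-row-≤ (bitVectors N) ⟩
        sumOver (λ A → weight A * W) (bitVectors N)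
          ≡⟨ sumOver-*ʳ W weight (bitVectors N) ⟩
        W * W
          ≡⟨ cong₂ _*_ (sum-weight N) (sum-weight N) ⟩
        (1ℚ + s) ^ℚ N * (1ℚ + s) ^ℚ N
          ≡⟨ sym (^ℚ-distribˡ-+-* (1ℚ + s) N N) ⟩
        (1ℚ + s) ^ℚ (N ℕ.+ N) ∎
        where
        open ℚ.≤-Reasoning
        W = sumOver weight (bitVectors N)
        row : Vec Bool N → List (Code N)
        row A = concatMap (codeBlock A) (bitVectors N)
        length-row-≤ : ∀ A → ℕ→ℚ (length (row A)) ≤ weight A * W
        length-row-≤ A = subst (ℕ→ℚ (length (row A)) ≤_)
          (sumOver-*ˡ (weight A) weight (bitVectors N))
          (length-concatMap-≤ (codeBlock A) (λ B → weight A * weight B) (length-codeBlock-≤ A) (bitVectors N))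

module PositiveReals (c : PosReal) where

  open import Data.Nat as ℕ using (zero; suc; s≤s)
  import Data.Nat.Properties as ℕ
  open import Data.Rational using (ℚ; _*_; _≤_; _<_; 0ℚ)
  import Data.Rational.Properties as ℚ
  open import Data.Product using (∃; ∃₂; _×_; _,_)
  open import Data.Sum using (inj₁; inj₂)
  open import Relation.Binary.PropositionalEquality using (refl)
  open RationalArithmetic
  open Squares

  BaseUpTo : (ℕ → ℕ) → ℕ → Set
  BaseUpTo S K = ∃ λ R → Lower c R × 0ℚ ≤ R × (∀ t → t ℕ.≤ K → ℕ→ℚ (S t) ≤ R ^ℚ t)

  module _ (S : ℕ → ℕ) {K : ℕ} where

    bounded-by-larger : ∀ {R r R'} → 0ℚ ≤ R → 0ℚ ≤ r → R ≤ R' → r ≤ R' →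
                        (∀ t → t ℕ.≤ K → ℕ→ℚ (S t) ≤ R ^ℚ t) → ℕ→ℚ (S (suc K)) < r ^ℚ suc K →
                        ∀ t → t ℕ.≤ suc K → ℕ→ℚ (S t) ≤ R' ^ℚ t
    bounded-by-larger 0≤R 0≤r R≤R' r≤R' S≤R^ S<r^ t t≤K+1 with ℕ.m≤n⇒m<n∨m≡n t≤K+1
    ... | inj₁ (s≤s t≤K) = ℚ.≤-trans (S≤R^ t t≤K) (^ℚ-monoˡ-≤ 0≤R R≤R' t)
    ... | inj₂ refl      = ℚ.≤-trans (ℚ.<⇒≤ S<r^) (^ℚ-monoˡ-≤ 0≤r r≤R' (suc K))

    extend-base : BaseUpTo S K → S (suc K) <pow c ^ suc K → BaseUpTo S (suc K)
    extend-base (R , R<c , 0≤R , S≤R^) (r , r<c , 0≤r , S<r^) with ℚ.≤-total R r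
    ... | inj₁ R≤r = r , r<c , 0≤r , bounded-by-larger 0≤R 0≤r R≤r ℚ.≤-refl S≤R^ S<r^
    ... | inj₂ r≤R = R , R<c , 0≤R , bounded-by-larger 0≤R 0≤r ℚ.≤-refl r≤R S≤R^ S<r^

  uniform-base : (S : ℕ → ℕ) → S 0 ℕ.≤ 1 → (∀ n → S (suc n) <pow c ^ suc n) → ∀ K → BaseUpTo S K
  uniform-base S S0≤1 S<c^ zero    = 0ℚ , pos c , ℚ.≤-refl , λ { zero _ → ℕ→ℚ-mono-≤ S0≤1 }
  uniform-base S S0≤1 S<c^ (suc K) = extend-base S (uniform-base S S0≤1 S<c^ K) (S<c^ K)

  squares-below : ∀ {R} → Lower c R → 0ℚ ≤ R →
                  ∃₂ λ s₀ s → 0ℚ ≤ s₀ × R ≤ s₀ * s₀ × s₀ < s × 0ℚ ≤ s × Lower c (s * s)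
  squares-below {R} R<c 0≤R =
    let (R₁ , R<R₁ , R₁<c) = rounded c R<c
        (s₀ , 0≤s₀ , R<s₀² , s₀²<R₁) = square-between {R} {R₁} 0≤R R<R₁
        (s , 0≤s , s₀²<s² , s²<R₁) = square-between {s₀ * s₀} {R₁} (0≤* 0≤s₀ 0≤s₀) s₀²<R₁
    in s₀ , s , 0≤s₀ , ℚ.<⇒≤ R<s₀² , <-of-square< 0≤s s₀²<s² , 0≤s , downward c (ℚ.<⇒≤ s²<R₁) R₁<c

import Data.Nat as ℕ
open import Data.List using (length)
open import Data.Product using (_,_)
open import Data.Rational using (_+_; 1ℚ)
import Data.Rational.Properties as ℚ
open Enumeration using (avoiders; avoiders-count; length-avoiders-0)
open Encoding using (codes; count≤length-codes)
open CodeCount using (length-codes-≤)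
open RationalArithmetic using (ℕ→ℚ-mono-≤; 0≤+; ^ℚ-monoˡ-≤; ^ℚ-monoˡ-<)
open PositiveReals using (uniform-base; squares-below)

lemma5p3 : (k : ℕ) (q : Vec (Fin (suc k)) (suc k)) → IsPerm q → head q ≡ zero →
    (c : PosReal) →
    (∀ (n m : ℕ) → HasCount (suc n) q m → m <pow c ^ (suc n)) →
    ∀ (n m : ℕ) → HasCount (suc n) (extend q) m → m <onePlusSqrt c ^2* (suc n)
lemma5p3 k q q-perm q-head c count<c^ n m count =
  let N = suc n
      (R , R<c , 0≤R , avoiders≤R^) =
        uniform-base c (λ t → length (avoiders q t)) (length-avoiders-0 q)
                     (λ t → count<c^ t _ (avoiders-count q (suc t))) N
      (s₀ , s , 0≤s₀ , R≤s₀² , s₀<s , 0≤s , s²<c) = squares-below c R<c 0≤R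
      avoiders≤s₀^ = λ t t≤N → ℚ.≤-trans (avoiders≤R^ t t≤N) (^ℚ-monoˡ-≤ 0≤R R≤s₀² t)
      open ℚ.≤-Reasoning
  in s , 0≤s , s²<c , (begin-strict
       ℕ→ℚ m                      ≤⟨ ℕ→ℚ-mono-≤ (count≤length-codes q q-perm q-head count) ⟩
       ℕ→ℚ (length (codes q N))   ≤⟨ length-codes-≤ q 0≤s₀ N avoiders≤s₀^ ⟩
       (1ℚ + s₀) ^ℚ (N ℕ.+ N)     <⟨ ^ℚ-monoˡ-< (0≤+ (ℚ.nonNegative⁻¹ 1ℚ) 0≤s₀) (ℚ.+-monoʳ-< 1ℚ s₀<s) (n ℕ.+ N) ⟩
       (1ℚ + s) ^ℚ (N ℕ.+ N)      ∎)
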